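{- Let $\kappa\ge 2$, let $\pi$ be a projective plane of order $\kappa$ and let $M=[A_{ij}]_{1\le i,j\le\kappa+1}$ be its incidence matrix in the normalized block form described in the context. Let $3\le j\le\kappa+1$ and let $i_1\neq i_2$ be in $\{2,\ldots,\kappa+1\}$. Then $A_{i_1j}$ and $A_{i_2j}$ have no entry equal to $1$ in the same position (same row and same column).
   Context: A projective plane is a finite geometry (points and lines, lines being sets of points, any two distinct points on exactly one common line, every line with at least two points) in which any two distinct lines intersect and which has four points no three on a line; its order $\kappa$ is the number of points on a line minus one; it has $n=\kappa^2+\kappa+1$ points and $n$ lines. Its incidence matrix $M=[m_{ij}]$ has $m_{ij}=1$ if line $\ell_i$ contains point $p_j$ and $0$ otherwise. Partition $\{1,\ldots,n\}$ into blocks: block $1=\{1,\ldots,\kappa+1\}$ and block $x=\{(x-1)\kappa+2,\ldots,x\kappa+1\}$ for $2\le x\le\kappa+1$; write $M=[A_{ij}]$ with rows and columns so partitioned. The normalized form means the labelling is such that: $A_{11}$ has ones exactly in its first row and first column; for $2\le r\le\kappa+1$, $A_{1r}$ has ones exactly in its $r$-th row and $A_{r1}$ has ones exactly in its $r$-th column; $A_{2j}=I_\kappa$ for $2\le j\le\kappa+1$; and $A_{i2}=I_\kappa$ for $3\le i\le\kappa+1$. -}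

module Defs where

open import Data.Nat using (ℕ; zero; suc; pred; _+_; _*_; _≤_)
open import Data.Bool using (Bool; true; false; if_then_else_)
open import Data.Fin using (Fin)
open import Data.Product using (Σ; _×_; _,_; ∃)
open import Data.Sum using (_⊎_)
open import Relation.Nullary using (¬_)
open import Relation.Binary.PropositionalEquality using (_≡_; _≢_)
open import Function.Bundles using (_⇔_)

-- A matrix with 1-based natural-number indices; only entries with
-- indices in 1..n matter.  Row i = line ℓ_i, column j = point p_j,
-- entry true = 1 (incidence), false = 0.
Mat : Set
Mat = ℕ → ℕ → Bool

size : ℕ → ℕ
size κ = κ * κ + κ + 1

InRange : ℕ → ℕ → Set
InRange n i = 1 ≤ i × i ≤ n

count : ℕ → (ℕ → Bool) → ℕ
count zero    f = 0
count (suc m) f = (if f (suc m) then 1 else 0) + count m f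

record IsProjectivePlaneIncidence (κ : ℕ) (M : Mat) : Set where
  field
    twoPointsOneLine : ∀ p q → InRange (size κ) p → InRange (size κ) q → p ≢ q →
      Σ ℕ λ l → (InRange (size κ) l × M l p ≡ true × M l q ≡ true) ×
        (∀ l′ → InRange (size κ) l′ → M l′ p ≡ true → M l′ q ≡ true → l′ ≡ l)
    linesMeet : ∀ l l′ → InRange (size κ) l → InRange (size κ) l′ → l ≢ l′ →
      Σ ℕ λ p → InRange (size κ) p × M l p ≡ true × M l′ p ≡ true
    lineTwoPoints : ∀ l → InRange (size κ) l → 2 ≤ count (size κ) (M l)
    fourPoints : Σ (Fin 4 → ℕ) λ P →
      (∀ a → InRange (size κ) (P a)) ×
      (∀ a b → a ≢ b → P a ≢ P b) ×
      (∀ l → InRange (size κ) l → ∀ a b c → a ≢ b → a ≢ c → b ≢ c →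
        ¬ (M l (P a) ≡ true × M l (P b) ≡ true × M l (P c) ≡ true))
    order : ∀ l → InRange (size κ) l → count (size κ) (M l) ≡ κ + 1

-- global (1-based) index of position a (1-based) inside block x:
-- block 1 = {1,…,κ+1}, block x = {(x-1)κ+2,…,xκ+1} for x ≥ 2.
pos : ℕ → ℕ → ℕ → ℕ
pos κ (suc zero) a = a
pos κ x          a = pred x * κ + 1 + a

bsize : ℕ → ℕ → ℕ
bsize κ (suc zero) = κ + 1
bsize κ x          = κ

blk : ℕ → Mat → ℕ → ℕ → ℕ → ℕ → Bool
blk κ M x y a b = M (pos κ x a) (pos κ y b)

BlockIs : ℕ → Mat → ℕ → ℕ → (ℕ → ℕ → Set) → Set
BlockIs κ M x y P = ∀ a b → InRange (bsize κ x) a → InRange (bsize κ y) b →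
  (blk κ M x y a b ≡ true) ⇔ P a b

record Normalized (κ : ℕ) (M : Mat) : Set where
  field
    A11 : BlockIs κ M 1 1 (λ a b → a ≡ 1 ⊎ b ≡ 1)
    A1r : ∀ r → 2 ≤ r → r ≤ κ + 1 → BlockIs κ M 1 r (λ a b → a ≡ r)
    Ar1 : ∀ r → 2 ≤ r → r ≤ κ + 1 → BlockIs κ M r 1 (λ a b → b ≡ r)
    A2j : ∀ j → 2 ≤ j → j ≤ κ + 1 → BlockIs κ M 2 j (λ a b → a ≡ b)
    Ai2 : ∀ i → 3 ≤ i → i ≤ κ + 1 → BlockIs κ M i 2 (λ a b → a ≡ b)

module Submission where

-- Row a of A_{i2} (i ≥ 2) is the line ℓ = pos i a, and
-- the normalisation A_{22} = A_{i2} = I puts the point p = pos 2 a (entry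
-- (a,a) of A_{i2}) on it.  If A_{i₁j} and A_{i₂j} both had a 1 at (a,b), the
-- two lines pos i₁ a and pos i₂ a would both pass through p and through the
-- point q = pos j b of block j ≥ 3.  Since block 2 lies strictly before
-- block j, p ≠ q, so by uniqueness of the line through two points the two
-- lines coincide; and since pos is injective in the block index, i₁ = i₂.

open import Defs
open import Data.Nat using (ℕ; _≤_; _<_; _+_; _*_; suc; zero; z≤n; s≤s)
open import Data.Nat.Properties
  using (≤-refl; ≤-trans; <-irrefl; m≤m+n; m≤n+m; m<m+n; +-mono-≤; +-monoˡ-≤; +-monoʳ-≤;
         *-monoˡ-≤; +-cancelʳ-≡; *-cancelʳ-≡; +-comm; ≤-pred; module ≤-Reasoning)
open import Data.Nat.Tactic.RingSolver using (solve-∀)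
open import Data.Product using (_×_; _,_; proj₂)
open import Relation.Nullary using (¬_)
open import Relation.Binary.PropositionalEquality
  using (_≡_; _≢_; refl; sym; trans; cong; subst)
open import Data.Bool using (true)
open import Function.Bundles using (Equivalence)

lastPlusOne≡nextBlock : ∀ k κ → suc k * κ + 1 + κ ≡ suc (suc k) * κ + 1
lastPlusOne≡nextBlock = solve-∀

size-rearranged : ∀ κ → κ * κ + 1 + κ ≡ κ * κ + κ + 1
size-rearranged = solve-∀

blockBound : ∀ {κ} k → suc (suc k) ≤ κ + 1 → suc k ≤ κ
blockBound {κ} k h = ≤-pred (subst (suc (suc k) ≤_) (+-comm κ 1) h)

pos-inRange : ∀ κ x a → 2 ≤ x → x ≤ κ + 1 → InRange κ a →
  InRange (size κ) (pos κ x a)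
pos-inRange κ (suc (suc k)) a (s≤s (s≤s _)) x≤κ+1 (_ , a≤κ) =
  ≤-trans (m≤n+m 1 (suc k * κ)) (m≤m+n (suc k * κ + 1) a) , upper
  where
  open ≤-Reasoning
  upper : suc k * κ + 1 + a ≤ size κ
  upper = begin
    suc k * κ + 1 + a ≤⟨ +-mono-≤ (+-monoˡ-≤ 1 (*-monoˡ-≤ κ (blockBound k x≤κ+1))) a≤κ ⟩
    κ * κ + 1 + κ     ≡⟨ size-rearranged κ ⟩
    size κ            ∎

pos-blockOrdered : ∀ κ x y a b → 2 ≤ x → x < y → a ≤ κ → 1 ≤ b →
  pos κ x a < pos κ y b
pos-blockOrdered κ (suc (suc k)) (suc (suc l)) a b (s≤s (s≤s _)) (s≤s x<y) a≤κ 1≤b = begin-strict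
  suc k * κ + 1 + a        ≤⟨ +-monoʳ-≤ (suc k * κ + 1) a≤κ ⟩
  suc k * κ + 1 + κ        ≡⟨ lastPlusOne≡nextBlock k κ ⟩
  suc (suc k) * κ + 1      ≤⟨ +-monoˡ-≤ 1 (*-monoˡ-≤ κ x<y) ⟩
  suc l * κ + 1            <⟨ m<m+n (suc l * κ + 1) 1≤b ⟩
  suc l * κ + 1 + b        ∎
  where open ≤-Reasoning

pos-injectiveInBlock : ∀ κ x y a → 1 ≤ κ → 2 ≤ x → 2 ≤ y →
  pos κ x a ≡ pos κ y a → x ≡ y
pos-injectiveInBlock (suc κ) (suc (suc k)) (suc (suc l)) a _ (s≤s (s≤s _)) (s≤s (s≤s _)) eq =
  cong suc (*-cancelʳ-≡ (suc k) (suc l) (suc κ)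
    (+-cancelʳ-≡ _ _ _ (+-cancelʳ-≡ _ _ _ eq)))

atMostOneLine : ∀ {κ M} → IsProjectivePlaneIncidence κ M →
  ∀ p q → InRange (size κ) p → InRange (size κ) q → p ≢ q →
  ∀ l l′ → InRange (size κ) l → InRange (size κ) l′ →
  M l p ≡ true → M l q ≡ true → M l′ p ≡ true → M l′ q ≡ true → l ≡ l′
atMostOneLine plane p q rp rq p≢q l l′ rl rl′ lp lq l′p l′q =
  trans (unique l rl lp lq) (sym (unique l′ rl′ l′p l′q))
  where
  unique = proj₂ (proj₂ (IsProjectivePlaneIncidence.twoPointsOneLine plane p q rp rq p≢q))

diagonal-Ax2 : ∀ {κ M} → Normalized κ M → ∀ x a → 2 ≤ x → x ≤ κ + 1 →
  InRange κ a → blk κ M x 2 a a ≡ true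
diagonal-Ax2 N (suc (suc zero)) a (s≤s (s≤s _)) x≤κ+1 ra =
  Equivalence.from (Normalized.A2j N 2 ≤-refl x≤κ+1 a a ra ra) refl
diagonal-Ax2 N (suc (suc (suc k))) a (s≤s (s≤s _)) x≤κ+1 ra =
  Equivalence.from (Normalized.Ai2 N (suc (suc (suc k))) (s≤s (s≤s (s≤s z≤n))) x≤κ+1 a a ra ra) refl

theorem21 : (κ : ℕ) → 2 ≤ κ → (M : Mat) →
    IsProjectivePlaneIncidence κ M → Normalized κ M →
    ∀ j → 3 ≤ j → j ≤ κ + 1 →
    ∀ i₁ i₂ → 2 ≤ i₁ → i₁ ≤ κ + 1 → 2 ≤ i₂ → i₂ ≤ κ + 1 → i₁ ≢ i₂ →
    ∀ a b → InRange κ a → InRange κ b →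
    ¬ (blk κ M i₁ j a b ≡ true × blk κ M i₂ j a b ≡ true)
theorem21 κ 2≤κ M plane N j 3≤j j≤κ+1 i₁ i₂ 2≤i₁ i₁≤κ+1 2≤i₂ i₂≤κ+1 i₁≢i₂
  a b ra@(_ , a≤κ) rb@(1≤b , _) (e₁ , e₂) = i₁≢i₂ sameBlock
  where
  p q : ℕ
  p = pos κ 2 a
  q = pos κ j b
  p≢q : p ≢ q
  p≢q p≡q = <-irrefl p≡q (pos-blockOrdered κ 2 j a b ≤-refl 3≤j a≤κ 1≤b)
  sameLine : pos κ i₁ a ≡ pos κ i₂ a
  sameLine = atMostOneLine plane p q
    (pos-inRange κ 2 a ≤-refl (≤-trans 2≤κ (m≤m+n κ 1)) ra)
    (pos-inRange κ j b (≤-trans (s≤s (s≤s z≤n)) 3≤j) j≤κ+1 rb) p≢q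
    (pos κ i₁ a) (pos κ i₂ a) (pos-inRange κ i₁ a 2≤i₁ i₁≤κ+1 ra) (pos-inRange κ i₂ a 2≤i₂ i₂≤κ+1 ra)
    (diagonal-Ax2 N i₁ a 2≤i₁ i₁≤κ+1 ra) e₁ (diagonal-Ax2 N i₂ a 2≤i₂ i₂≤κ+1 ra) e₂
  sameBlock : i₁ ≡ i₂
  sameBlock = pos-injectiveInBlock κ i₁ i₂ a (≤-trans (s≤s z≤n) 2≤κ) 2≤i₁ 2≤i₂ sameLine
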